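{- Let $d\ge1$ and $2\le k$, $2k\le n$ be integers, and let $(G_0, G_1, \ldots, G_r)$ be an $(n, d, k, 2k)$-system of grids. Then for any $0 \leq i \leq r$ and any $G_i$-block $B$ it holds that $|\mathrm{Par}(B)| / |B| < 3^d$.
   Context: For an interval $I\subseteq[n]$, $I[\colon\ell]$ is the set of its $\ell$ smallest elements. An $(n,w)$-interval partition is a partition of $[n]$ into increasingly ordered intervals of sizes $w$ or $w+1$; the $(n,d,k,w)$-grid it induces (for $2\le k\le w$) is $\{x\in[n]^d:\exists i,\ x_i\in\bigcup_j I_j[\colon k-1]\}$; $\mathcal{G}(n,d,k,w)$ is the family of these grids. For a grid $G$, a $G$-block is a connected component of $[n]^d\setminus G$ under adjacency $\sum_i|x_i-y_i|=1$. An $(n,d,k,w)$-system of grids is a tuple $(G_0,\dots,G_r)$, $r=\lfloor\log_2(n/w)\rfloor$, with $G_i\in\mathcal{G}(n,d,k,\lfloor n/2^{r-i}\rfloor)$ and $G_0\supseteq G_1\supseteq\dots\supseteq G_r$; then every $G_i$-block is contained in a unique $G_{i+1}$-block, called its parent $\mathrm{Par}(B)$ (for $i<r$); for the $G_r$-block, $\mathrm{Par}$ is defined to be $[n]^d$. -}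

module Defs where

open import Data.Nat using (ℕ; zero; suc; _+_; _*_; _∸_; _^_; _≤_; _<_; ∣_-_∣; _/_)
open import Data.Nat.Logarithm using (⌊log₂_⌋)
open import Data.Fin using (Fin; toℕ)
open import Data.Vec using (Vec; lookup; zipWith; allFin)
open import Data.List using (List; []; _∷_; length)
open import Data.List.Relation.Unary.All using (All)
open import Data.List.Relation.Unary.Unique.Propositional using (Unique)
open import Data.List.Membership.Propositional using (_∈_)
open import Data.Product using (Σ; ∃; ∃-syntax; _×_)
open import Data.Sum using (_⊎_)
open import Data.Empty using (⊥)
open import Relation.Nullary using (¬_)
open import Relation.Binary.PropositionalEquality using (_≡_)
open import Function.Bundles using (_⇔_)

-- Points of [n]^d, coordinates 0-indexed (value v ∈ Fin n stands for v+1 ∈ [n]).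
Point : ℕ → ℕ → Set
Point n d = Vec (Fin n) d

vsum : ∀ {m} → Vec ℕ m → ℕ
vsum Vec.[] = 0
vsum (x Vec.∷ xs) = x + vsum xs

Adj : ∀ {n d} → Point n d → Point n d → Set
Adj x y = vsum (zipWith (λ a b → ∣ toℕ a - toℕ b ∣) x y) ≡ 1

-- An (n,w)-interval partition, given by the list of sizes of its consecutive
-- increasingly ordered intervals I_1, I_2, ... (I_1 starts at the smallest element).
sumL : List ℕ → ℕ
sumL [] = 0
sumL (s ∷ ss) = s + sumL ss

IntervalPartition : ℕ → ℕ → List ℕ → Set
IntervalPartition n w P = All (λ s → s ≡ w ⊎ s ≡ suc w) P × sumL P ≡ n

-- InHead ℓ P v : the (0-indexed) value v lies in ⋃_j I_j[:ℓ]
InHead : ℕ → List ℕ → ℕ → Set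
InHead ℓ [] v = ⊥
InHead ℓ (s ∷ ss) v = (v < s × v < ℓ) ⊎ (s ≤ v × InHead ℓ ss (v ∸ s))

Grid : ∀ {n d} → ℕ → List ℕ → Point n d → Set
Grid {n} {d} k P x = ∃[ i ] InHead (k ∸ 1) P (toℕ (lookup x i))

data Conn {n d} (G : Point n d → Set) : Point n d → Point n d → Set where
  here : ∀ {x} → ¬ G x → Conn G x x
  step : ∀ {x y z} → Conn G x y → Adj y z → ¬ G z → Conn G x z

IsBlock : ∀ {n d} → (Point n d → Set) → (Point n d → Set) → Set
IsBlock G B = ∃[ x₀ ] (¬ G x₀ × (∀ y → B y ⇔ Conn G x₀ y))

-- floor division, total (division by 0 never occurs in use: w = 2k ≥ 4, 2^j ≥ 1)
_div_ : ℕ → ℕ → ℕ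
n div zero = 0
n div suc w = n / suc w

-- r = ⌊log₂(n/w)⌋  (equal to ⌊log₂ ⌊n/w⌋⌋)
rOf : (n w : ℕ) → ℕ
rOf n w = ⌊log₂ (n div w) ⌋

-- (n,d,k,w)-system of grids, given by the interval partitions P 0, …, P r
IsSystem : (n d k w : ℕ) → (ℕ → List ℕ) → Set
IsSystem n d k w P =
  (∀ i → i ≤ rOf n w → IntervalPartition n (n div (2 ^ (rOf n w ∸ i))) (P i))
  × (∀ i → i < rOf n w → ∀ (x : Point n d) → Grid k (P (suc i)) x → Grid k (P i) x)

IsPar : ∀ {n d} → ℕ → ℕ → (ℕ → List ℕ) → ℕ → (Point n d → Set) → (Point n d → Set) → Set
IsPar {n} {d} r k P i B Q with i Data.Nat.<? r
... | Relation.Nullary.yes _ = IsBlock (Grid k (P (suc i))) Q × (∀ y → B y → Q y)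
... | Relation.Nullary.no _ = ∀ y → Q y

-- L is a duplicate-free enumeration of the set S (so |S| = length L)
Enumerates : ∀ {n d} → List (Point n d) → (Point n d → Set) → Set
Enumerates L S = Unique L × (∀ y → (y ∈ L) ⇔ S y)

-- For a point x₀ off the grid G_i, each coordinate of x₀ lies in an interval of the level-i
-- partition but not among its first k − 1 elements (its head).  The block of x₀ is exactly the
-- product of these interval tails: the tails are connected, and the values adjacent to a tail
-- are heads.  So |B| = ∏_c (s_c − (k − 1)) where s_c ≥ 2k is the size of the level-i interval
-- containing x₀_c; likewise Par(B) lies in the product of the level-(i+1) tails, of sizes
-- s′_c − (k − 1), or is [n]^d at the top level.  As the grids are nested, every level-(i+1)
-- interval is a union of consecutive level-i intervals, whose sizes are W_i or W_i + 1, and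
-- W_{i+1} ≤ 2W_i + 1; a parent of size 2W_i + 2 would consist of two intervals of size W_i + 1,
-- so s′_c ≤ 2s_c + 1 in all cases.  With s_c ≥ 2k this gives s′_c − (k − 1) < 3 (s_c − (k − 1)),
-- and multiplying over the d ≥ 1 coordinates gives the strict bound 3^d.

module Submission where

open import Defs
open import Data.Nat
open import Data.Nat.Properties
open import Data.Nat.DivMod
  using (_%_; m*n/n≡m; /-monoˡ-≤; /-monoʳ-≤; m/n*n≤m; m≥n⇒m/n>0; n/1≡n; m/n/o≡m/[n*o]; /-congʳ; m≡m%n+[m/n]*n; m%n<n)
open import Data.Nat.Induction using (<-rec)
open import Data.Nat.Logarithm using (⌊log₂_⌋; ⌊log₂⌋-mono-≤; ⌊log₂⌊n/2⌋⌋≡⌊log₂n⌋∸1; ⌊log₂[2^n]⌋≡n)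
open import Data.Nat.Tactic.RingSolver using (solve-∀)
open import Data.Fin using (Fin; toℕ; fromℕ<) renaming (zero to fzero; suc to fsuc)
open import Data.Fin.Properties using (toℕ-injective; toℕ-fromℕ<; toℕ<n)
open import Data.Vec using (Vec; []; _∷_; zipWith; lookup; map; replicate)
open import Data.Vec.Properties using (∷-injective; zipWith-comm; lookup-map; lookup-replicate)
open import Data.Vec.Relation.Binary.Pointwise.Inductive using (Pointwise; []; _∷_)
open import Data.Vec.Relation.Unary.All as VAll using ([]; _∷_)
open import Data.List as List using (List; []; _∷_; [_]; _++_; length; cartesianProductWith)
open import Data.List.Properties using (length-removeAt′; length-++; length-map)
open import Data.List.Relation.Unary.Any using (here; there; index; _─_)
open import Data.List.Relation.Unary.All as All using (All; []; _∷_)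
open import Data.List.Relation.Unary.AllPairs using ([]; _∷_)
open import Data.List.Relation.Unary.Unique.Propositional using (Unique)
open import Data.List.Relation.Unary.Unique.Propositional.Properties using (cartesianProductWith⁺)
open import Data.List.Membership.Propositional using (_∈_)
open import Data.List.Membership.Propositional.Properties using (∈-cartesianProductWith⁺; ∈-cartesianProductWith⁻)
open import Data.List.Relation.Binary.Subset.Propositional using (_⊆_)
open import Data.Product using (Σ; _×_; _,_; proj₁; proj₂)
open import Data.Sum using (_⊎_; inj₁; inj₂)
open import Data.Empty using (⊥-elim)
open import Function using (_∘_)
open import Function.Bundles using (Equivalence)
open import Relation.Nullary using (¬_; yes; no; contradiction)
open import Relation.Binary.PropositionalEquality
  using (_≡_; _≢_; refl; sym; trans; cong; cong₂; subst; subst₂; module ≡-Reasoning)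

∈-─ : {A : Set} {x z : A} {ys : List A} (x∈ys : x ∈ ys) → z ∈ ys → z ≢ x → z ∈ (ys ─ x∈ys)
∈-─ (here refl)  (here refl)  z≢x = ⊥-elim (z≢x refl)
∈-─ (here _)     (there z∈ys) _   = z∈ys
∈-─ (there _)    (here refl)  _   = here refl
∈-─ (there x∈ys) (there z∈ys) z≢x = there (∈-─ x∈ys z∈ys z≢x)

unique⊆⇒length≤ : {A : Set} {xs ys : List A} → Unique xs → xs ⊆ ys → length xs ≤ length ys
unique⊆⇒length≤ {xs = []} _ _ = z≤n
unique⊆⇒length≤ {xs = x ∷ xs} {ys} (x∉xs ∷ xs!) xs⊆ys = begin
  suc (length xs)          ≤⟨ s≤s (unique⊆⇒length≤ xs! xs⊆ys─x) ⟩
  suc (length (ys ─ x∈ys)) ≡⟨ length-removeAt′ ys (index x∈ys) ⟨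
  length ys                ∎
  where
  open ≤-Reasoning
  x∈ys = xs⊆ys (here refl)
  xs⊆ys─x : xs ⊆ (ys ─ x∈ys)
  xs⊆ys─x z∈xs = ∈-─ x∈ys (xs⊆ys (there z∈xs)) (λ z≡x → All.lookup x∉xs z∈xs (sym z≡x))

length-cartesianProductWith : {A B C : Set} (f : A → B → C) (xs : List A) (ys : List B) →
                              length (cartesianProductWith f xs ys) ≡ length xs * length ys
length-cartesianProductWith f []       ys = refl
length-cartesianProductWith f (x ∷ xs) ys = begin
  length (List.map (f x) ys ++ cartesianProductWith f xs ys) ≡⟨ length-++ (List.map (f x) ys) ⟩
  length (List.map (f x) ys) + length (cartesianProductWith f xs ys)
    ≡⟨ cong₂ _+_ (length-map (f x) ys) (length-cartesianProductWith f xs ys) ⟩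
  length ys + length xs * length ys ∎
  where open ≡-Reasoning

-- Boxes

width : ℕ × ℕ → ℕ
width (l , h) = h ∸ l

volume : ∀ {d} → Vec (ℕ × ℕ) d → ℕ
volume []      = 1
volume (I ∷ b) = width I * volume b

volume-< : ∀ {d} c (b b′ : Vec (ℕ × ℕ) (suc d)) →
           (∀ i → width (lookup b′ i) < c * width (lookup b i)) → volume b′ < c ^ suc d * volume b
volume-< {zero} c (I ∷ []) (I′ ∷ []) w′<cw = begin-strict
  width I′ * 1           ≡⟨ *-identityʳ (width I′) ⟩
  width I′               <⟨ w′<cw fzero ⟩
  c * width I            ≡⟨ cong₂ _*_ (*-identityʳ c) (*-identityʳ (width I)) ⟨
  c ^ 1 * (width I * 1)  ∎
  where open ≤-Reasoning
volume-< {suc d} c (I ∷ b) (I′ ∷ b′) w′<cw = begin-strict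
  width I′ * volume b′                  ≤⟨ *-monoˡ-≤ (volume b′) (<⇒≤ (w′<cw fzero)) ⟩
  c * width I * volume b′               <⟨ *-monoʳ-< (c * width I) {{cw≢0}} (volume-< c b b′ (w′<cw ∘ fsuc)) ⟩
  c * width I * (c ^ suc d * volume b)  ≡⟨ swap-middle c (width I) (c ^ suc d) (volume b) ⟩
  c ^ suc (suc d) * (width I * volume b) ∎
  where
  open ≤-Reasoning
  cw≢0 = >-nonZero (≤-<-trans z≤n (w′<cw fzero))
  swap-middle : ∀ c w p v → c * w * (p * v) ≡ c * p * (w * v)
  swap-middle = solve-∀

module _ {n : ℕ} where

  _∈ᴵ_ : Fin n → ℕ × ℕ → Set
  a ∈ᴵ (l , h) = l ≤ toℕ a × toℕ a < h

  finsFrom : ℕ → ℕ → List (Fin n)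
  finsFrom l zero = []
  finsFrom l (suc len) with l <? n
  ... | yes l<n = fromℕ< l<n ∷ finsFrom (suc l) len
  ... | no _    = []

  length-finsFrom : ∀ l len → l + len ≤ n → length (finsFrom l len) ≡ len
  length-finsFrom l zero _ = refl
  length-finsFrom l (suc len) l+len≤n with l <? n
  ... | yes _   = cong suc (length-finsFrom (suc l) len (subst (_≤ n) (+-suc l len) l+len≤n))
  ... | no l≮n = contradiction (<-≤-trans (m<m+n l z<s) l+len≤n) l≮n

  ∈-finsFrom⁺ : ∀ l len (a : Fin n) → l ≤ toℕ a → toℕ a < l + len → a ∈ finsFrom l len
  ∈-finsFrom⁺ l zero a l≤a a<l+0 = contradiction (subst (toℕ a <_) (+-identityʳ l) a<l+0) (≤⇒≯ l≤a)
  ∈-finsFrom⁺ l (suc len) a l≤a a<end with l <? n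
  ... | no l≮n = contradiction (≤-<-trans l≤a (toℕ<n a)) l≮n
  ... | yes l<n with m≤n⇒m<n∨m≡n l≤a
  ...   | inj₁ l<a = there (∈-finsFrom⁺ (suc l) len a l<a (subst (toℕ a <_) (+-suc l len) a<end))
  ...   | inj₂ refl = here (toℕ-injective (sym (toℕ-fromℕ< l<n)))

  ∈-finsFrom⁻ : ∀ l len {a : Fin n} → a ∈ finsFrom l len → l ≤ toℕ a × toℕ a < l + len
  ∈-finsFrom⁻ l (suc len) a∈ with l <? n
  ∈-finsFrom⁻ l (suc len) (here refl) | yes l<n rewrite toℕ-fromℕ< l<n = ≤-refl , m<m+n l z<s
  ∈-finsFrom⁻ l (suc len) {a} (there a∈) | yes l<n with ∈-finsFrom⁻ (suc l) len a∈
  ... | l<a , a<end = <⇒≤ l<a , subst (toℕ a <_) (sym (+-suc l len)) a<end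

  finsFrom-unique : ∀ l len → Unique (finsFrom l len)
  finsFrom-unique l zero = []
  finsFrom-unique l (suc len) with l <? n
  ... | no _ = []
  ... | yes l<n = All.tabulate fresh ∷ finsFrom-unique (suc l) len
    where
    fresh : ∀ {b} → b ∈ finsFrom (suc l) len → fromℕ< l<n ≢ b
    fresh b∈ refl = <-irrefl (sym (toℕ-fromℕ< l<n)) (proj₁ (∈-finsFrom⁻ (suc l) len b∈))

  fins : ℕ × ℕ → List (Fin n)
  fins (l , h) = finsFrom l (h ∸ l)

  ∈-fins⁺ : ∀ {a I} → a ∈ᴵ I → a ∈ fins I
  ∈-fins⁺ {a} {l , h} (l≤a , a<h) = ∈-finsFrom⁺ l (h ∸ l) a l≤a (<-≤-trans a<h (m≤n+m∸n h l))

  ∈-fins⁻ : ∀ {a I} → a ∈ fins I → a ∈ᴵ I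
  ∈-fins⁻ {a} {l , h} a∈ = l≤a , subst (toℕ a <_) (m+[n∸m]≡n (<⇒≤ l<h)) a<l+[h∸l]
    where
    l≤a = proj₁ (∈-finsFrom⁻ l (h ∸ l) a∈)
    a<l+[h∸l] = proj₂ (∈-finsFrom⁻ l (h ∸ l) a∈)
    l<h : l < h
    l<h = m∸n≢0⇒n<m λ h∸l≡0 →
      ≤⇒≯ l≤a (subst (toℕ a <_) (trans (cong (l +_) h∸l≡0) (+-identityʳ l)) a<l+[h∸l])

  _∈ᴮ_ : ∀ {d} → Point n d → Vec (ℕ × ℕ) d → Set
  z ∈ᴮ b = Pointwise _∈ᴵ_ z b

  Bounded : ∀ {d} → Vec (ℕ × ℕ) d → Set
  Bounded = VAll.All (λ I → proj₂ I ≤ n)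

  boxPoints : ∀ {d} → Vec (ℕ × ℕ) d → List (Point n d)
  boxPoints []      = [ [] ]
  boxPoints (I ∷ b) = cartesianProductWith _∷_ (fins I) (boxPoints b)

  length-boxPoints : ∀ {d} (b : Vec (ℕ × ℕ) d) → Bounded b → length (boxPoints b) ≡ volume b
  length-boxPoints [] [] = refl
  length-boxPoints ((l , h) ∷ b) (h≤n ∷ b-bounded) = begin
    length (boxPoints ((l , h) ∷ b))       ≡⟨ length-cartesianProductWith _∷_ (fins (l , h)) (boxPoints b) ⟩
    length (fins (l , h)) * length (boxPoints b) ≡⟨ cong₂ _*_ length-fins (length-boxPoints b b-bounded) ⟩
    (h ∸ l) * volume b                     ∎
    where
    open ≡-Reasoning
    length-fins : length (fins (l , h)) ≡ h ∸ l
    length-fins with l ≤? h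
    ... | yes l≤h = length-finsFrom l (h ∸ l) (subst (_≤ n) (sym (m+[n∸m]≡n l≤h)) h≤n)
    ... | no l≰h rewrite m≤n⇒m∸n≡0 (≰⇒≥ l≰h) = refl

  ∈-boxPoints⁺ : ∀ {d} {z : Point n d} {b} → z ∈ᴮ b → z ∈ boxPoints b
  ∈-boxPoints⁺ [] = here refl
  ∈-boxPoints⁺ (a∈I ∷ z∈b) = ∈-cartesianProductWith⁺ _∷_ (∈-fins⁺ a∈I) (∈-boxPoints⁺ z∈b)

  ∈-boxPoints⁻ : ∀ {d} {z : Point n d} b → z ∈ boxPoints b → z ∈ᴮ b
  ∈-boxPoints⁻ [] (here refl) = []
  ∈-boxPoints⁻ (I ∷ b) z∈ with ∈-cartesianProductWith⁻ _∷_ (fins I) (boxPoints b) z∈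
  ... | _ , _ , a∈ , y∈ , refl = ∈-fins⁻ a∈ ∷ ∈-boxPoints⁻ b y∈

  boxPoints-unique : ∀ {d} (b : Vec (ℕ × ℕ) d) → Unique (boxPoints b)
  boxPoints-unique []      = All.[] ∷ []
  boxPoints-unique ((l , h) ∷ b) =
    cartesianProductWith⁺ _∷_ ∷-injective (finsFrom-unique l (h ∸ l)) (boxPoints-unique b)

  volume≤length : ∀ {d} {S : Point n d → Set} {L} b → Bounded b →
                  (∀ z → z ∈ᴮ b → S z) → Enumerates L S → volume b ≤ length L
  volume≤length {L = L} b b-bounded b⊆S (_ , L⇔S) = begin
    volume b             ≡⟨ length-boxPoints b b-bounded ⟨
    length (boxPoints b) ≤⟨ unique⊆⇒length≤ (boxPoints-unique b) b⊆L ⟩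
    length L             ∎
    where
    open ≤-Reasoning
    b⊆L : boxPoints b ⊆ L
    b⊆L {z} z∈ = Equivalence.from (L⇔S z) (b⊆S z (∈-boxPoints⁻ b z∈))

  length≤volume : ∀ {d} {S : Point n d → Set} {L} b → Bounded b →
                  (∀ z → S z → z ∈ᴮ b) → Enumerates L S → length L ≤ volume b
  length≤volume {L = L} b b-bounded S⊆b (L! , L⇔S) = begin
    length L             ≤⟨ unique⊆⇒length≤ L! L⊆b ⟩
    length (boxPoints b) ≡⟨ length-boxPoints b b-bounded ⟩
    volume b             ∎
    where
    open ≤-Reasoning
    L⊆b : L ⊆ boxPoints b
    L⊆b {z} z∈L = ∈-boxPoints⁺ (S⊆b z (Equivalence.to (L⇔S z) z∈L))

length<-via-boxes : ∀ {n d} {S T : Point n (suc d) → Set} {LS LT} (b b′ : Vec (ℕ × ℕ) (suc d)) →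
                    Bounded {n} b → Bounded {n} b′ →
                    (∀ z → z ∈ᴮ b → S z) → (∀ z → T z → z ∈ᴮ b′) →
                    (∀ c → width (lookup b′ c) < 3 * width (lookup b c)) →
                    Enumerates LS S → Enumerates LT T → length LT < 3 ^ suc d * length LS
length<-via-boxes {d = d} {LS = LS} {LT} b b′ b-bounded b′-bounded b⊆S T⊆b′ narrow enumS enumT = begin-strict
  length LT             ≤⟨ length≤volume b′ b′-bounded T⊆b′ enumT ⟩
  volume b′             <⟨ volume-< 3 b b′ narrow ⟩
  3 ^ suc d * volume b  ≤⟨ *-monoʳ-≤ (3 ^ suc d) (volume≤length b b-bounded b⊆S enumS) ⟩
  3 ^ suc d * length LS ∎
  where open ≤-Reasoning

fullBox : ℕ → (d : ℕ) → Vec (ℕ × ℕ) d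
fullBox n d = replicate d (0 , n)

∈-fullBox : ∀ {n d} (z : Point n d) → z ∈ᴮ fullBox n d
∈-fullBox []      = []
∈-fullBox (a ∷ z) = (z≤n , toℕ<n a) ∷ ∈-fullBox z

fullBox-bounded : ∀ n d → Bounded {n} (fullBox n d)
fullBox-bounded n zero    = []
fullBox-bounded n (suc d) = ≤-refl ∷ fullBox-bounded n d

-- Paths avoiding a set

module _ {n : ℕ} where

  distance : ∀ {d} → Point n d → Point n d → ℕ
  distance x y = vsum (zipWith (λ a b → ∣ toℕ a - toℕ b ∣) x y)

  distance-self : ∀ {d} (x : Point n d) → distance x x ≡ 0
  distance-self []      = refl
  distance-self (a ∷ x) = cong₂ _+_ (∣n-n∣≡0 (toℕ a)) (distance-self x)

  distance≡0⇒≡ : ∀ {d} (x y : Point n d) → distance x y ≡ 0 → x ≡ y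
  distance≡0⇒≡ []      []      _ = refl
  distance≡0⇒≡ (a ∷ x) (b ∷ y) eq = cong₂ _∷_
    (toℕ-injective (∣m-n∣≡0⇒m≡n (m+n≡0⇒m≡0 _ eq))) (distance≡0⇒≡ x y (m+n≡0⇒n≡0 _ eq))

  Adj-sym : ∀ {d} {x y : Point n d} → Adj x y → Adj y x
  Adj-sym {x = x} {y} xy = trans (cong vsum (zipWith-comm (λ a b → ∣-∣-comm (toℕ a) (toℕ b)) y x)) xy

  Adj-∷ : ∀ {d} (a : Fin n) {x y : Point n d} → Adj x y → Adj (a ∷ x) (a ∷ y)
  Adj-∷ a xy = trans (cong (_+ _) (∣n-n∣≡0 (toℕ a))) xy

  Adj-succ : ∀ {d} {a b : Fin n} (y : Point n d) → toℕ b ≡ suc (toℕ a) → Adj (a ∷ y) (b ∷ y)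
  Adj-succ {a = a} y b≡1+a =
    cong₂ _+_ (trans (cong (∣ toℕ a -_∣) b≡1+a) (∣m-1+m∣ (toℕ a))) (distance-self y)
    where
    ∣m-1+m∣ : ∀ m → ∣ m - suc m ∣ ≡ 1
    ∣m-1+m∣ zero    = refl
    ∣m-1+m∣ (suc m) = ∣m-1+m∣ m

  Adj-∷⁻ : ∀ {d} {a b : Fin n} {x y : Point n d} → Adj (a ∷ x) (b ∷ y) →
           (toℕ a ≡ toℕ b × Adj x y) ⊎ (∣ toℕ a - toℕ b ∣ ≡ 1 × x ≡ y)
  Adj-∷⁻ {a = a} {b} {x} {y} adj with ∣ toℕ a - toℕ b ∣ in eq
  ... | 0 = inj₁ (∣m-n∣≡0⇒m≡n eq , adj)
  ... | 1 = inj₂ (refl , distance≡0⇒≡ x y (suc-injective adj))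

  module _ {d} {G : Point n d → Set} where

    Conn-end : ∀ {x y} → Conn G x y → ¬ G y
    Conn-end (here ¬Gx)     = ¬Gx
    Conn-end (step _ _ ¬Gz) = ¬Gz

    Conn-trans : ∀ {x y z} → Conn G x y → Conn G y z → Conn G x z
    Conn-trans xy (here _)         = xy
    Conn-trans xy (step yz adj ¬G) = step (Conn-trans xy yz) adj ¬G

    Conn-sym : ∀ {x y} → Conn G x y → Conn G y x
    Conn-sym (here ¬Gx)        = here ¬Gx
    Conn-sym (step {x} {y} {z} xy adj ¬Gz) =
      Conn-trans (step (here ¬Gz) (Adj-sym {x = y} {z} adj) (Conn-end xy)) (Conn-sym xy)

  Conn-∷ : ∀ {d} {G : Point n (suc d) → Set} (a : Fin n) {x y} →
           Conn (λ z → G (a ∷ z)) x y → Conn G (a ∷ x) (a ∷ y)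
  Conn-∷ a (here ¬G)        = here ¬G
  Conn-∷ a (step {x} {y} {z} c adj ¬G) = step (Conn-∷ a c) (Adj-∷ a {y} {z} adj) ¬G

  interval-climb : ∀ {d} {G : Point n (suc d) → Set} (y : Point n d) {I} →
                   (∀ t → t ∈ᴵ I → ¬ G (t ∷ y)) →
                   ∀ j {a c} → toℕ c ≡ toℕ a + j → a ∈ᴵ I → c ∈ᴵ I → Conn G (a ∷ y) (c ∷ y)
  interval-climb y free zero {a} {c} c≡a+0 a∈I _
    rewrite toℕ-injective (trans c≡a+0 (+-identityʳ (toℕ a))) = here (free a a∈I)
  interval-climb y {l , h} free (suc j) {a} {c} c≡a+1+j a∈I c∈I =
    step (interval-climb y free j (toℕ-fromℕ< a+j<n) a∈I c′∈I) (Adj-succ y c≡1+c′) (free c c∈I)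
    where
    c≡1+a+j : toℕ c ≡ suc (toℕ a + j)
    c≡1+a+j = trans c≡a+1+j (+-suc (toℕ a) j)
    a+j<n : toℕ a + j < n
    a+j<n = <-trans (n<1+n _) (subst (_< n) c≡1+a+j (toℕ<n c))
    c′ = fromℕ< a+j<n
    c≡1+c′ : toℕ c ≡ suc (toℕ c′)
    c≡1+c′ = trans c≡1+a+j (cong suc (sym (toℕ-fromℕ< a+j<n)))
    c′∈I : c′ ∈ᴵ (l , h)
    c′∈I = subst (λ v → l ≤ v × v < h) (sym (toℕ-fromℕ< a+j<n))
      (≤-trans (proj₁ a∈I) (m≤m+n (toℕ a) j) , <-trans (n<1+n _) (subst (_< h) c≡1+a+j (proj₂ c∈I)))

  interval-connected : ∀ {d} {G : Point n (suc d) → Set} (y : Point n d) {I} →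
                       (∀ t → t ∈ᴵ I → ¬ G (t ∷ y)) →
                       ∀ {a b} → a ∈ᴵ I → b ∈ᴵ I → Conn G (a ∷ y) (b ∷ y)
  interval-connected y free {a} {b} a∈I b∈I with ≤-total (toℕ a) (toℕ b)
  ... | inj₁ a≤b = interval-climb y free (toℕ b ∸ toℕ a) (sym (m+[n∸m]≡n a≤b)) a∈I b∈I
  ... | inj₂ b≤a = Conn-sym (interval-climb y free (toℕ a ∸ toℕ b) (sym (m+[n∸m]≡n b≤a)) b∈I a∈I)

  box-connected : ∀ {d} {G : Point n d → Set} {b} → (∀ z → z ∈ᴮ b → ¬ G z) →
                  ∀ {x y} → x ∈ᴮ b → y ∈ᴮ b → Conn G x y
  box-connected free [] [] = here (free [] [])
  box-connected free {a ∷ x} {c ∷ y} (a∈I ∷ x∈b) (c∈I ∷ y∈b) = Conn-trans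
    (Conn-∷ a (box-connected (λ z z∈b → free (a ∷ z) (a∈I ∷ z∈b)) x∈b y∈b))
    (interval-connected y (λ t t∈I → free (t ∷ y) (t∈I ∷ y∈b)) a∈I c∈I)

  -- The values l − 1 and h adjacent to [l, h) are in H.
  Isolated : (ℕ → Set) → ℕ × ℕ → Set
  Isolated H (l , h) = ∀ (u : Fin n) → ¬ H (toℕ u) → u ∈ᴵ (l , h) ⊎ suc (toℕ u) < l ⊎ h < toℕ u

  isolated-step : ∀ (H : ℕ → Set) {I} {a c : Fin n} → Isolated H I → a ∈ᴵ I →
                  ∣ toℕ a - toℕ c ∣ ≡ 1 → ¬ H (toℕ c) → c ∈ᴵ I
  isolated-step H {l , h} {a} {c} iso (l≤a , a<h) ∣a-c∣≡1 ¬Hc with iso c ¬Hc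
  ... | inj₁ c∈I          = c∈I
  ... | inj₂ (inj₁ c+1<l) = contradiction (≤-trans l≤a (subst (toℕ a ≤_) (+-comm (toℕ c) 1) a≤c+1)) (<⇒≱ c+1<l)
    where
    a≤c+1 = subst (λ k → toℕ a ≤ toℕ c + k) ∣a-c∣≡1 (m≤n+∣m-n∣ (toℕ a) (toℕ c))
  ... | inj₂ (inj₂ h<c)   = contradiction (≤-trans c≤a+1 (subst (_≤ h) (+-comm 1 (toℕ a)) a<h)) (<⇒≱ h<c)
    where
    c≤a+1 = subst (λ k → toℕ c ≤ toℕ a + k) (trans (∣-∣-comm (toℕ c) (toℕ a)) ∣a-c∣≡1)
                  (m≤n+∣m-n∣ (toℕ c) (toℕ a))

  isolated-Adj : ∀ {d} (H : ℕ → Set) {b : Vec (ℕ × ℕ) d} → VAll.All (Isolated H) b →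
                 ∀ {y z} → y ∈ᴮ b → Adj y z → (∀ c → ¬ H (toℕ (lookup z c))) → z ∈ᴮ b
  isolated-Adj H [] {[]} {[]} [] _ _ = []
  isolated-Adj H {(l , h) ∷ _} (iso ∷ isos) {a ∷ y} {c ∷ z} (a∈I ∷ y∈b) adj ¬Hz
    with Adj-∷⁻ {a = a} {c} {y} {z} adj
  ... | inj₁ (a≡c , adj′) =
    subst (λ v → l ≤ v × v < h) a≡c a∈I ∷ isolated-Adj H isos y∈b adj′ (λ i → ¬Hz (fsuc i))
  ... | inj₂ (∣a-c∣≡1 , y≡z) =
    isolated-step H iso a∈I ∣a-c∣≡1 (¬Hz fzero) ∷ subst (_∈ᴮ _) y≡z y∈b

  box-closed : ∀ {d} {G : Point n d → Set} (H : ℕ → Set) {b} → VAll.All (Isolated H) b →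
               (∀ z c → H (toℕ (lookup z c)) → G z) →
               ∀ {x y} → x ∈ᴮ b → Conn G x y → y ∈ᴮ b
  box-closed H isos H⊆G x∈b (here _) = x∈b
  box-closed H isos H⊆G x∈b (step {x} {y} {z} c adj ¬Gz) =
    isolated-Adj H isos (box-closed H isos H⊆G x∈b c) adj (λ i Hz → ¬Gz (H⊆G z i Hz))

-- Interval partitions

-- For v ≥ sumL P these return junk values, hence the hypotheses v < sumL P below.
intervalStart : List ℕ → ℕ → ℕ
intervalStart []       v = 0
intervalStart (s ∷ ss) v with v <? s
... | yes _ = 0
... | no  _ = s + intervalStart ss (v ∸ s)

intervalSize : List ℕ → ℕ → ℕ
intervalSize []       v = 0
intervalSize (s ∷ ss) v with v <? s
... | yes _ = s
... | no  _ = intervalSize ss (v ∸ s)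

∸-<-sumL : ∀ s ss {v} → v < s + sumL ss → s ≤ v → v ∸ s < sumL ss
∸-<-sumL s ss v<s+Σ s≤v = subst (_ <_) (m+n∸m≡n s (sumL ss)) (∸-monoˡ-< v<s+Σ s≤v)

start-zero : ∀ P → intervalStart P 0 ≡ 0
start-zero []           = refl
start-zero (zero  ∷ ss) = start-zero ss
start-zero (suc s ∷ ss) = refl

start≤ : ∀ P v → intervalStart P v ≤ v
start≤ []       v = z≤n
start≤ (s ∷ ss) v with v <? s
... | yes _   = z≤n
... | no  v≮s =
  subst (s + intervalStart ss (v ∸ s) ≤_) (m+[n∸m]≡n (≮⇒≥ v≮s)) (+-monoʳ-≤ s (start≤ ss (v ∸ s)))

<start+size : ∀ P {v} → v < sumL P → v < intervalStart P v + intervalSize P v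
<start+size (s ∷ ss) {v} v<Σ with v <? s
... | yes v<s = v<s
... | no  v≮s = begin-strict
  v                                    ≡⟨ m+[n∸m]≡n (≮⇒≥ v≮s) ⟨
  s + w                                <⟨ +-monoʳ-< s (<start+size ss (∸-<-sumL s ss v<Σ (≮⇒≥ v≮s))) ⟩
  s + (intervalStart ss w + intervalSize ss w) ≡⟨ +-assoc s _ _ ⟨
  s + intervalStart ss w + intervalSize ss w   ∎
  where
  open ≤-Reasoning
  w = v ∸ s

start+size≤sumL : ∀ P v → intervalStart P v + intervalSize P v ≤ sumL P
start+size≤sumL []       v = z≤n
start+size≤sumL (s ∷ ss) v with v <? s
... | yes _ = m≤m+n s (sumL ss)
... | no  _ = subst (_≤ s + sumL ss) (sym (+-assoc s _ _)) (+-monoʳ-≤ s (start+size≤sumL ss (v ∸ s)))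

size-All : ∀ {Q : ℕ → Set} P {v} → All Q P → v < sumL P → Q (intervalSize P v)
size-All (s ∷ ss) {v} (Qs ∷ Qss) v<Σ with v <? s
... | yes _   = Qs
... | no  v≮s = size-All ss Qss (∸-<-sumL s ss v<Σ (≮⇒≥ v≮s))

InHead⇒<start+ : ∀ ℓ P {v} → InHead ℓ P v → v < intervalStart P v + ℓ
InHead⇒<start+ ℓ (s ∷ ss) {v} head with v <? s | head
... | yes _   | inj₁ (_ , v<ℓ)  = v<ℓ
... | yes v<s | inj₂ (s≤v , _)  = contradiction s≤v (<⇒≱ v<s)
... | no  v≮s | inj₁ (v<s , _)  = contradiction v<s v≮s
... | no  _   | inj₂ (s≤v , h) = begin-strict
  v                          ≡⟨ m+[n∸m]≡n s≤v ⟨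
  s + (v ∸ s)                <⟨ +-monoʳ-< s (InHead⇒<start+ ℓ ss h) ⟩
  s + (intervalStart ss (v ∸ s) + ℓ) ≡⟨ +-assoc s _ ℓ ⟨
  s + intervalStart ss (v ∸ s) + ℓ   ∎
  where open ≤-Reasoning

<start+⇒InHead : ∀ ℓ P {v} → v < sumL P → v < intervalStart P v + ℓ → InHead ℓ P v
<start+⇒InHead ℓ (s ∷ ss) {v} v<Σ v<start+ℓ with v <? s
... | yes v<s = inj₁ (v<s , v<start+ℓ)
... | no  v≮s =
  inj₂ (s≤v , <start+⇒InHead ℓ ss (∸-<-sumL s ss v<Σ s≤v) (+-cancelˡ-< s _ _ s+[v∸s]<s+[start+ℓ]))
  where
  s≤v = ≮⇒≥ v≮s
  s+[v∸s]<s+[start+ℓ] = subst₂ _<_ (sym (m+[n∸m]≡n s≤v)) (+-assoc s _ ℓ) v<start+ℓ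

start-size-cong : ∀ P {u v} → intervalStart P v ≤ u → u < intervalStart P v + intervalSize P v →
                  intervalStart P u ≡ intervalStart P v × intervalSize P u ≡ intervalSize P v
start-size-cong []       _ _ = refl , refl
start-size-cong (s ∷ ss) {u} {v} start≤u u<end with v <? s | u <? s
... | yes _   | yes _   = refl , refl
... | yes _   | no  u≮s = contradiction u<end u≮s
... | no  _   | yes u<s = contradiction (≤-trans (m≤m+n s _) start≤u) (<⇒≱ u<s)
... | no  _   | no  u≮s with start-size-cong ss {u ∸ s} {v ∸ s}
        (subst (_≤ u ∸ s) (m+n∸m≡n s _) (∸-monoˡ-≤ s start≤u))
        (subst (u ∸ s <_) (trans (cong (_∸ s) (+-assoc s _ _)) (m+n∸m≡n s _))
               (∸-monoˡ-< u<end (≮⇒≥ u≮s)))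
...   | start≡ , size≡ = cong (s +_) start≡ , size≡

start-of-end : ∀ P {v} → v < sumL P → intervalStart P v + intervalSize P v < sumL P →
               intervalStart P (intervalStart P v + intervalSize P v) ≡ intervalStart P v + intervalSize P v
start-of-end (s ∷ ss) {v} v<Σ end<Σ with v <? s
... | yes _ with s <? s
...   | yes s<self = contradiction s<self (n≮n s)
...   | no  _      = begin
  s + intervalStart ss (s ∸ s) ≡⟨ cong (λ t → s + intervalStart ss t) (n∸n≡0 s) ⟩
  s + intervalStart ss 0       ≡⟨ cong (s +_) (start-zero ss) ⟩
  s + 0                        ≡⟨ +-identityʳ s ⟩
  s                            ∎
  where open ≡-Reasoning
start-of-end (s ∷ ss) {v} v<Σ end<Σ | no v≮s with s + intervalStart ss (v ∸ s) + intervalSize ss (v ∸ s) <? s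
... | yes end<s = contradiction (≤-trans (m≤m+n s _) (m≤m+n _ _)) (<⇒≱ end<s)
... | no  _     = begin
  s + intervalStart ss (s + intervalStart ss w + intervalSize ss w ∸ s)
                                      ≡⟨ cong (λ t → s + intervalStart ss t) end∸s ⟩
  s + intervalStart ss end′           ≡⟨ cong (s +_) (start-of-end ss (∸-<-sumL s ss v<Σ (≮⇒≥ v≮s)) end′<Σ) ⟩
  s + end′                            ≡⟨ +-assoc s _ _ ⟨
  s + intervalStart ss w + intervalSize ss w ∎
  where
  open ≡-Reasoning
  w = v ∸ s
  end′ = intervalStart ss w + intervalSize ss w
  end∸s : s + intervalStart ss w + intervalSize ss w ∸ s ≡ end′
  end∸s = trans (cong (_∸ s) (+-assoc s _ _)) (m+n∸m≡n s end′)
  end′<Σ : end′ < sumL ss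
  end′<Σ = +-cancelˡ-< s _ _ (subst (_< s + sumL ss) (+-assoc s _ _) end<Σ)

IsStart : List ℕ → ℕ → Set
IsStart P c = c < sumL P × intervalStart P c ≡ c

module _ (P : List ℕ) where

  IsStart-next : ∀ {c} → IsStart P c → c + intervalSize P c < sumL P → IsStart P (c + intervalSize P c)
  IsStart-next {c} (c<Σ , start≡c) end<Σ =
    end<Σ , subst (λ t → intervalStart P (t + intervalSize P c) ≡ t + intervalSize P c) start≡c
                  (start-of-end P c<Σ (subst (λ t → t + intervalSize P c < sumL P) (sym start≡c) end<Σ))

  intervalSize-within : ∀ {c v} → IsStart P c → c ≤ v → v < c + intervalSize P c →
                        intervalSize P v ≡ intervalSize P c
  intervalSize-within {c} {v} (_ , start≡c) c≤v v<end = proj₂ (start-size-cong P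
    (subst (_≤ v) (sym start≡c) c≤v) (subst (λ t → v < t + intervalSize P c) (sym start≡c) v<end))

  no-boundary-inside : ∀ {c e} → IsStart P c → c < e → e < c + intervalSize P c →
                       ¬ (e ≡ sumL P ⊎ IsStart P e)
  no-boundary-inside {c} (c<Σ , start≡c) c<e e<end (inj₁ refl) =
    <⇒≱ e<end (subst (λ t → t + intervalSize P c ≤ sumL P) start≡c (start+size≤sumL P c))
  no-boundary-inside {c} {e} (c<Σ , start≡c) c<e e<end (inj₂ (_ , start≡e)) = <⇒≢ c<e (begin
    c                  ≡⟨ start≡c ⟨
    intervalStart P c  ≡⟨ proj₁ (start-size-cong P (subst (_≤ e) (sym start≡c) (<⇒≤ c<e))
                             (subst (λ t → e < t + intervalSize P c) (sym start≡c) e<end)) ⟨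
    intervalStart P e  ≡⟨ start≡e ⟩
    e                  ∎)
    where open ≡-Reasoning

-- Nested interval partitions

module _ (m : ℕ) (P P′ : List ℕ) (Σ≡ : sumL P′ ≡ sumL P)
         (heads-nested : ∀ {u} → u < sumL P → InHead (suc m) P′ u → InHead (suc m) P u)
         (P-large : ∀ {c} → c < sumL P → 2 * suc m ≤ intervalSize P c)
         (P′-large : ∀ {c} → c < sumL P → 2 * suc m ≤ intervalSize P′ c) where

  -- c and c + m are heads of P′, hence of P; as P-intervals are long, both lie in the
  -- P-interval of c, which therefore starts at c.
  starts-nested : ∀ {c} → IsStart P′ c → IsStart P c
  starts-nested {c} (c<Σ′ , start′≡c) = c<Σ , ≤-antisym (start≤ P c) c≤start
    where
    c<Σ : c < sumL P
    c<Σ = subst (c <_) Σ≡ c<Σ′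
    s = intervalStart P c
    c+m<c+size′ : c + m < c + intervalSize P′ c
    c+m<c+size′ = +-monoʳ-< c (<-≤-trans (s≤s (m≤m+n m (suc (m + 0)))) (P′-large c<Σ))
    c+m<Σ : c + m < sumL P
    c+m<Σ = <-≤-trans c+m<c+size′
      (subst₂ (λ t Σ → t + intervalSize P′ c ≤ Σ) start′≡c Σ≡ (start+size≤sumL P′ c))
    start′[c+m]≡c : intervalStart P′ (c + m) ≡ c
    start′[c+m]≡c = trans (proj₁ (start-size-cong P′
      (subst (_≤ c + m) (sym start′≡c) (m≤m+n c m))
      (subst (λ t → c + m < t + intervalSize P′ c) (sym start′≡c) c+m<c+size′))) start′≡c
    c-head : c < s + suc m
    c-head = InHead⇒<start+ (suc m) P (heads-nested c<Σ
      (<start+⇒InHead (suc m) P′ c<Σ′ (subst (λ t → c < t + suc m) (sym start′≡c) (m<m+n c z<s))))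
    c+m-head : c + m < intervalStart P (c + m) + suc m
    c+m-head = InHead⇒<start+ (suc m) P (heads-nested c+m<Σ
      (<start+⇒InHead (suc m) P′ (subst (c + m <_) (sym Σ≡) c+m<Σ)
        (subst (λ t → c + m < t + suc m) (sym start′[c+m]≡c) (+-monoʳ-< c (n<1+n m)))))
    c+m<s+size : c + m < s + intervalSize P c
    c+m<s+size = begin-strict
      c + m           <⟨ +-monoˡ-< m c-head ⟩
      s + suc m + m   ≡⟨ +-assoc s (suc m) m ⟩
      s + suc (m + m) <⟨ +-monoʳ-< s (s≤s (+-monoʳ-< m (s≤s (≤-reflexive (sym (+-identityʳ m)))))) ⟩
      s + 2 * suc m   ≤⟨ +-monoʳ-≤ s (P-large c<Σ) ⟩
      s + intervalSize P c ∎
      where open ≤-Reasoning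
    start[c+m]≡s : intervalStart P (c + m) ≡ s
    start[c+m]≡s = proj₁ (start-size-cong P (≤-trans (start≤ P c) (m≤m+n c m)) c+m<s+size)
    c≤start : c ≤ s
    c≤start = +-cancelʳ-≤ m c s (≤-pred (subst (suc (c + m) ≤_)
      (trans (cong (_+ suc m) start[c+m]≡s) (+-suc s m)) c+m-head))

module _ (P P′ : List ℕ) (Σ≡ : sumL P′ ≡ sumL P)
         (starts⊆ : ∀ {c} → IsStart P′ c → IsStart P c)
         (W : ℕ) (3≤W : 3 ≤ W)
         (P-sizes : ∀ {c} → c < sumL P → intervalSize P c ≡ W ⊎ intervalSize P c ≡ suc W) where

  private
    size = intervalSize P

    W≤size : ∀ {c} → c < sumL P → W ≤ size c
    W≤size c<Σ with P-sizes c<Σ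
    ... | inj₁ size≡W  = ≤-reflexive (sym size≡W)
    ... | inj₂ size≡1+W = subst (W ≤_) (sym size≡1+W) (n≤1+n W)

    size≤1+W : ∀ {c} → c < sumL P → size c ≤ suc W
    size≤1+W c<Σ with P-sizes c<Σ
    ... | inj₁ size≡W  = subst (_≤ suc W) (sym size≡W) (n≤1+n W)
    ... | inj₂ size≡1+W = ≤-reflexive size≡1+W

    W<2[1+W] : W < 2 * suc W
    W<2[1+W] = <-≤-trans (n<1+n W) (m≤m+n (suc W) _)

    W+1+W<2[1+W] : W + suc W < 2 * suc W
    W+1+W<2[1+W] = subst (W + suc W <_) (cong (suc W +_) (sym (+-identityʳ (suc W)))) (n<1+n (W + suc W))

    2[1+W]<3W : 2 * suc W < W + W + W
    2[1+W]<3W = begin-strict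
      2 * suc W     ≡⟨ cong (suc W +_) (+-identityʳ (suc W)) ⟩
      suc W + suc W ≡⟨ +-suc (suc W) W ⟩
      suc (suc W + W) ≡⟨ +-comm 2 (W + W) ⟩
      W + W + 2     <⟨ +-monoʳ-< (W + W) 3≤W ⟩
      W + W + W     ∎
      where open ≤-Reasoning

    next : ℕ → ℕ
    next c = c + size c

    +W≤next : ∀ {c} → c < sumL P → c + W ≤ next c
    +W≤next {c} c<Σ = +-monoʳ-≤ c (W≤size c<Σ)

    second-next-inside : ∀ {a v} → IsStart P a → a ≤ v → v < a + 2 * suc W → a + 2 * suc W ≤ sumL P →
                         size v ≡ W → IsStart P (next (next a)) × next (next a) < a + 2 * suc W
    second-next-inside {a} {v} a-start a≤v v<e e≤Σ size≡W =
      IsStart-next P c₁-start (<-≤-trans c₂<e e≤Σ) , c₂<e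
      where
      c₁ = next a
      c₂ = next c₁
      c₁<Σ : c₁ < sumL P
      c₁<Σ with v <? c₁
      ... | no  v≮c₁ = ≤-<-trans (≮⇒≥ v≮c₁) (<-≤-trans v<e e≤Σ)
      ... | yes v<c₁ = <-≤-trans (+-monoʳ-< a (subst (_< 2 * suc W) (sym size-a≡W) W<2[1+W])) e≤Σ
        where
        size-a≡W : size a ≡ W
        size-a≡W = trans (sym (intervalSize-within P a-start a≤v v<c₁)) size≡W
      c₁-start : IsStart P c₁
      c₁-start = IsStart-next P a-start c₁<Σ
      two-sizes : v < c₂ → size a + size c₁ ≤ W + suc W
      two-sizes v<c₂ with v <? c₁
      ... | yes v<c₁ = +-mono-≤ (≤-reflexive (trans (sym (intervalSize-within P a-start a≤v v<c₁)) size≡W))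
                                (size≤1+W c₁<Σ)
      ... | no  v≮c₁ = subst (_≤ W + suc W) (+-comm (size c₁) (size a)) (+-mono-≤
            (≤-reflexive (trans (sym (intervalSize-within P c₁-start (≮⇒≥ v≮c₁) v<c₂)) size≡W))
            (size≤1+W (proj₁ a-start)))
      c₂<e : c₂ < a + 2 * suc W
      c₂<e with c₂ ≤? v
      ... | yes c₂≤v = ≤-<-trans c₂≤v v<e
      ... | no  c₂≰v = subst (_< a + 2 * suc W) (sym (+-assoc a (size a) (size c₁)))
                         (+-monoʳ-< a (≤-<-trans (two-sizes (≰⇒> c₂≰v)) W+1+W<2[1+W]))

  -- A parent interval of length 2W + 2 is tiled by child intervals of length W or W + 1, hence by
  -- exactly two of length W + 1.
  no-merge-of-short : ∀ {v} → v < sumL P → intervalSize P v ≡ W → intervalSize P′ v ≢ 2 * suc W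
  no-merge-of-short {v} v<Σ size≡W size′≡ =
    no-boundary-inside P c₂-start c₂<e e<next[c₂] e-boundary
    where
    v<Σ′ = subst (v <_) (sym Σ≡) v<Σ
    a = intervalStart P′ v
    e = a + 2 * suc W
    a≤v : a ≤ v
    a≤v = start≤ P′ v
    v<e : v < e
    v<e = subst (λ t → v < a + t) size′≡ (<start+size P′ v<Σ′)
    e≤Σ : e ≤ sumL P
    e≤Σ = subst₂ (λ t Σ → a + t ≤ Σ) size′≡ Σ≡ (start+size≤sumL P′ v)
    a<end′ : a < a + intervalSize P′ v
    a<end′ = ≤-<-trans a≤v (<start+size P′ v<Σ′)
    a-start′ : IsStart P′ a
    a-start′ = ≤-<-trans a≤v v<Σ′ , proj₁ (start-size-cong P′ ≤-refl a<end′)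
    size′a≡ : intervalSize P′ a ≡ 2 * suc W
    size′a≡ = trans (proj₂ (start-size-cong P′ ≤-refl a<end′)) size′≡
    e-boundary : e ≡ sumL P ⊎ IsStart P e
    e-boundary with e <? sumL P
    ... | no  e≮Σ = inj₁ (≤-antisym e≤Σ (≮⇒≥ e≮Σ))
    ... | yes e<Σ = inj₂ (starts⊆ (subst (λ t → IsStart P′ (a + t)) size′a≡
          (IsStart-next P′ a-start′ (subst₂ (λ t Σ → a + t < Σ) (sym size′a≡) (sym Σ≡) e<Σ))))
    a-start = starts⊆ a-start′
    c₁ = next a
    c₂ = next c₁
    c₂-start = proj₁ (second-next-inside a-start a≤v v<e e≤Σ size≡W)
    c₂<e = proj₂ (second-next-inside a-start a≤v v<e e≤Σ size≡W)
    c₂<Σ = proj₁ c₂-start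
    c₁<Σ = ≤-<-trans (m≤m+n c₁ (size c₁)) c₂<Σ
    e<next[c₂] : e < next c₂
    e<next[c₂] = begin-strict
      a + 2 * suc W   <⟨ +-monoʳ-< a 2[1+W]<3W ⟩
      a + (W + W + W) ≡⟨ cong (a +_) (+-assoc W W W) ⟩
      a + (W + (W + W)) ≡⟨ +-assoc a W (W + W) ⟨
      a + W + (W + W) ≡⟨ +-assoc (a + W) W W ⟨
      a + W + W + W   ≤⟨ +-monoˡ-≤ W (+-monoˡ-≤ W (+W≤next (proj₁ a-start))) ⟩
      c₁ + W + W      ≤⟨ +-monoˡ-≤ W (+W≤next c₁<Σ) ⟩
      c₂ + W          ≤⟨ +W≤next c₂<Σ ⟩
      next c₂         ∎
      where open ≤-Reasoning

  parent-size≤ : (∀ {c} → c < sumL P → intervalSize P′ c ≤ 2 * suc W) →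
                 ∀ {v} → v < sumL P → intervalSize P′ v ≤ suc (2 * intervalSize P v)
  parent-size≤ P′-small {v} v<Σ with P-sizes v<Σ
  ... | inj₁ size≡W = subst (λ s → intervalSize P′ v ≤ suc (2 * s)) (sym size≡W)
          (≤-pred (subst (intervalSize P′ v <_) (*-suc 2 W)
            (≤∧≢⇒< (P′-small v<Σ) (no-merge-of-short v<Σ size≡W))))
  ... | inj₂ size≡1+W =
    subst (λ s → intervalSize P′ v ≤ suc (2 * s)) (sym size≡1+W) (m≤n⇒m≤1+n (P′-small v<Σ))

-- Blocks of a grid

intervalTail : ℕ → List ℕ → ℕ → ℕ × ℕ
intervalTail ℓ P v = intervalStart P v + ℓ , intervalStart P v + intervalSize P v

width-intervalTail : ∀ ℓ P v → width (intervalTail ℓ P v) ≡ intervalSize P v ∸ ℓ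
width-intervalTail ℓ P v = [m+n]∸[m+o]≡n∸o (intervalStart P v) (intervalSize P v) ℓ

tail-ratio : ∀ ℓ s w → 2 * suc ℓ ≤ s → w + ℓ ≤ suc (2 * s) → w < 3 * (s ∸ ℓ)
tail-ratio ℓ s w 2[1+ℓ]≤s w+ℓ≤1+2s =
  subst (suc w ≤_) (sym (*-distribˡ-∸ 3 s ℓ)) (m+n≤o⇒m≤o∸n (suc w) (begin
    suc w + 3 * ℓ             ≡⟨ e₁ w ℓ ⟩
    suc (w + ℓ) + 2 * ℓ       ≤⟨ +-monoˡ-≤ (2 * ℓ) (s≤s w+ℓ≤1+2s) ⟩
    suc (suc (2 * s)) + 2 * ℓ ≡⟨ e₂ s ℓ ⟩
    2 * s + 2 * suc ℓ         ≤⟨ +-monoʳ-≤ (2 * s) 2[1+ℓ]≤s ⟩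
    2 * s + s                 ≡⟨ e₃ s ⟩
    3 * s                     ∎))
  where
  open ≤-Reasoning
  e₁ : ∀ w ℓ → suc w + 3 * ℓ ≡ suc (w + ℓ) + 2 * ℓ
  e₁ = solve-∀
  e₂ : ∀ s ℓ → suc (suc (2 * s)) + 2 * ℓ ≡ 2 * s + 2 * suc ℓ
  e₂ = solve-∀
  e₃ : ∀ s → 2 * s + s ≡ 3 * s
  e₃ = solve-∀

tailBox : ∀ {n d} → ℕ → List ℕ → Point n d → Vec (ℕ × ℕ) d
tailBox ℓ P x = map (intervalTail ℓ P ∘ toℕ) x

module _ {n : ℕ} (ℓ : ℕ) (P : List ℕ) (ΣP≡n : sumL P ≡ n) where

  private
    <Σ : ∀ {v} → v < n → v < sumL P
    <Σ = subst (_ <_) (sym ΣP≡n)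

  ∈-intervalTail : (a : Fin n) → ¬ InHead ℓ P (toℕ a) → a ∈ᴵ intervalTail ℓ P (toℕ a)
  ∈-intervalTail a ¬head =
    ≮⇒≥ (¬head ∘ <start+⇒InHead ℓ P (<Σ (toℕ<n a))) , <start+size P (<Σ (toℕ<n a))

  intervalTail-headless : ∀ v {u : Fin n} → u ∈ᴵ intervalTail ℓ P v → ¬ InHead ℓ P (toℕ u)
  intervalTail-headless v {u} (start+ℓ≤u , u<end) head = ≤⇒≯ start+ℓ≤u
    (subst (λ s → toℕ u < s + ℓ) start≡ (InHead⇒<start+ ℓ P head))
    where
    start≡ : intervalStart P (toℕ u) ≡ intervalStart P v
    start≡ = proj₁ (start-size-cong P (≤-trans (m≤m+n _ ℓ) start+ℓ≤u) u<end)

  intervalTail-bounded : ∀ v → proj₂ (intervalTail ℓ P v) ≤ n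
  intervalTail-bounded v = subst (_ ≤_) ΣP≡n (start+size≤sumL P v)

  intervalTail-isolated : 1 ≤ ℓ → ∀ {v} → v < n → Isolated {n} (InHead ℓ P) (intervalTail ℓ P v)
  intervalTail-isolated 1≤ℓ {v} v<n u ¬head with toℕ u <? intervalStart P v
  ... | yes u<start = inj₂ (inj₁ (<-≤-trans (s≤s u<start)
          (subst (_≤ intervalStart P v + ℓ) (+-comm (intervalStart P v) 1) (+-monoʳ-≤ (intervalStart P v) 1≤ℓ))))
  ... | no  u≮start with toℕ u <? intervalStart P v + intervalSize P v
  ...   | yes u<end = inj₁ (subst (λ s → s + ℓ ≤ toℕ u) start≡ start[u]+ℓ≤u , u<end)
    where
    start≡ = proj₁ (start-size-cong P (≮⇒≥ u≮start) u<end)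
    start[u]+ℓ≤u = ≮⇒≥ (¬head ∘ <start+⇒InHead ℓ P (<Σ (toℕ<n u)))
  ...   | no  u≮end with intervalStart P v + intervalSize P v <? toℕ u
  ...     | yes end<u = inj₂ (inj₂ end<u)
  ...     | no  end≮u = contradiction (<start+⇒InHead ℓ P (<Σ (toℕ<n u)) u<start[u]+ℓ) ¬head
    where
    end≡u : intervalStart P v + intervalSize P v ≡ toℕ u
    end≡u = ≤-antisym (≮⇒≥ u≮end) (≮⇒≥ end≮u)
    start[u]≡u : intervalStart P (toℕ u) ≡ toℕ u
    start[u]≡u = subst (λ t → intervalStart P t ≡ t) end≡u
      (start-of-end P (<Σ v<n) (subst (_< sumL P) (sym end≡u) (<Σ (toℕ<n u))))
    u<start[u]+ℓ : toℕ u < intervalStart P (toℕ u) + ℓ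
    u<start[u]+ℓ = subst (λ t → toℕ u < t + ℓ) (sym start[u]≡u) (m<m+n (toℕ u) 1≤ℓ)

  ∈-tailBox : ∀ {d} (x : Point n d) → ¬ Grid (suc ℓ) P x → x ∈ᴮ tailBox ℓ P x
  ∈-tailBox []      _     = []
  ∈-tailBox (a ∷ x) x∉G = ∈-intervalTail a (λ head → x∉G (fzero , head))
                        ∷ ∈-tailBox x (λ (i , head) → x∉G (fsuc i , head))

  tailBox-gridFree : ∀ {d} (x : Point n d) {z : Point n d} → z ∈ᴮ tailBox ℓ P x → ¬ Grid (suc ℓ) P z
  tailBox-gridFree (a ∷ x) (u∈tail ∷ _)   (fzero , head)  = intervalTail-headless (toℕ a) u∈tail head
  tailBox-gridFree (a ∷ x) (_ ∷ z∈box)    (fsuc i , head) = tailBox-gridFree x z∈box (i , head)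

  tailBox-bounded : ∀ {d} (x : Point n d) → Bounded {n} (tailBox ℓ P x)
  tailBox-bounded []      = []
  tailBox-bounded (a ∷ x) = intervalTail-bounded (toℕ a) ∷ tailBox-bounded x

  tailBox-isolated : 1 ≤ ℓ → ∀ {d} (x : Point n d) → VAll.All (Isolated {n} (InHead ℓ P)) (tailBox ℓ P x)
  tailBox-isolated 1≤ℓ []      = []
  tailBox-isolated 1≤ℓ (a ∷ x) = intervalTail-isolated 1≤ℓ (toℕ<n a) ∷ tailBox-isolated 1≤ℓ x

  tailBox⊆component : ∀ {d} {x₀ : Point n d} → ¬ Grid (suc ℓ) P x₀ →
                      ∀ {z} → z ∈ᴮ tailBox ℓ P x₀ → Conn (Grid (suc ℓ) P) x₀ z
  tailBox⊆component {x₀ = x₀} x₀∉G z∈box =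
    box-connected (λ z → tailBox-gridFree x₀) (∈-tailBox x₀ x₀∉G) z∈box

  component⊆tailBox : 1 ≤ ℓ → ∀ {d} {x₀ : Point n d} → ¬ Grid (suc ℓ) P x₀ →
                      ∀ {y} → Conn (Grid (suc ℓ) P) x₀ y → y ∈ᴮ tailBox ℓ P x₀
  component⊆tailBox 1≤ℓ {x₀ = x₀} x₀∉G =
    box-closed (InHead ℓ P) (tailBox-isolated 1≤ℓ x₀) (λ z i head → i , head) (∈-tailBox x₀ x₀∉G)

-- Widths of the levels of a system of grids

div≡/ : ∀ n m .{{_ : NonZero m}} → n div m ≡ n / m
div≡/ n (suc m) = refl

2^⌊log₂n⌋≤n : ∀ n → 1 ≤ n → 2 ^ ⌊log₂ n ⌋ ≤ n
2^⌊log₂n⌋≤n = <-rec (λ n → 1 ≤ n → 2 ^ ⌊log₂ n ⌋ ≤ n) bound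
  where
  bound : ∀ n → (∀ {m} → m < n → 1 ≤ m → 2 ^ ⌊log₂ m ⌋ ≤ m) → 1 ≤ n → 2 ^ ⌊log₂ n ⌋ ≤ n
  bound 1 _ _ = ≤-refl
  bound n@(suc (suc m)) rec _ = begin
    2 ^ ⌊log₂ n ⌋               ≡⟨ cong (2 ^_) log-n ⟩
    2 * 2 ^ ⌊log₂ ⌊ n /2⌋ ⌋    ≤⟨ *-monoʳ-≤ 2 (rec (⌊n/2⌋<n (suc m)) z<s) ⟩
    2 * ⌊ n /2⌋                 ≡⟨ cong (⌊ n /2⌋ +_) (+-identityʳ ⌊ n /2⌋) ⟩
    ⌊ n /2⌋ + ⌊ n /2⌋           ≤⟨ +-monoʳ-≤ ⌊ n /2⌋ (⌊n/2⌋≤⌈n/2⌉ n) ⟩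
    ⌊ n /2⌋ + ⌈ n /2⌉           ≡⟨ ⌊n/2⌋+⌈n/2⌉≡n n ⟩
    n                           ∎
    where
    open ≤-Reasoning
    1≤log-n : 1 ≤ ⌊log₂ n ⌋
    1≤log-n = subst (_≤ ⌊log₂ n ⌋) (⌊log₂[2^n]⌋≡n 1) (⌊log₂⌋-mono-≤ {2} {n} (s≤s (s≤s z≤n)))
    log-n : ⌊log₂ n ⌋ ≡ suc ⌊log₂ ⌊ n /2⌋ ⌋
    log-n = trans (sym (suc-pred ⌊log₂ n ⌋ {{>-nonZero 1≤log-n}}))
                  (cong suc (sym (⌊log₂⌊n/2⌋⌋≡⌊log₂n⌋∸1 n)))

levelWidth : ℕ → ℕ → ℕ → ℕ
levelWidth n w j = n div (2 ^ (rOf n w ∸ j))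

levelWidth-lower : ∀ n w .{{_ : NonZero w}} → w ≤ n → ∀ j → w ≤ levelWidth n w j
levelWidth-lower n w w≤n j = begin
  w                   ≡⟨ m*n/n≡m w (2 ^ r) ⟨
  w * 2 ^ r / 2 ^ r   ≤⟨ /-monoˡ-≤ (2 ^ r) w*2^r≤n ⟩
  n / 2 ^ r           ≤⟨ /-monoʳ-≤ n (^-monoʳ-≤ 2 (m∸n≤m r j)) ⟩
  n / 2 ^ (r ∸ j)     ≡⟨ div≡/ n (2 ^ (r ∸ j)) ⟨
  levelWidth n w j    ∎
  where
  open ≤-Reasoning
  r = rOf n w
  instance
    2^r≢0 : NonZero (2 ^ r)
    2^r≢0 = m^n≢0 2 r
    2^[r∸j]≢0 : NonZero (2 ^ (r ∸ j))
    2^[r∸j]≢0 = m^n≢0 2 (r ∸ j)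
  2^r≤n/w : 2 ^ r ≤ n / w
  2^r≤n/w = subst (λ t → 2 ^ ⌊log₂ t ⌋ ≤ n / w) (sym (div≡/ n w))
                  (2^⌊log₂n⌋≤n (n / w) (m≥n⇒m/n>0 w≤n))
  w*2^r≤n : w * 2 ^ r ≤ n
  w*2^r≤n = ≤-trans (≤-reflexive (*-comm w (2 ^ r))) (≤-trans (*-monoˡ-≤ w 2^r≤n/w) (m/n*n≤m n w))

levelWidth-step : ∀ n w {j} → j < rOf n w → levelWidth n w (suc j) ≤ suc (2 * levelWidth n w j)
levelWidth-step n w {j} j<r = subst₂ (λ u t → u ≤ suc (2 * t)) (sym (div≡/ n (2 ^ e))) (sym W≡x/2) x≤1+2[x/2]
  where
  r = rOf n w
  e = r ∸ suc j
  instance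
    2^e≢0 : NonZero (2 ^ e)
    2^e≢0 = m^n≢0 2 e
    2*2^e≢0 : NonZero (2 * 2 ^ e)
    2*2^e≢0 = m^n≢0 2 (suc e)
    2^e*2≢0 : NonZero (2 ^ e * 2)
    2^e*2≢0 = m*n≢0 (2 ^ e) 2
  x = n / 2 ^ e
  r∸j≡1+e : r ∸ j ≡ suc e
  r∸j≡1+e = +-∸-assoc 1 j<r
  W≡x/2 : levelWidth n w j ≡ x / 2
  W≡x/2 = begin
    n div (2 ^ (r ∸ j))   ≡⟨ cong (λ t → n div (2 ^ t)) r∸j≡1+e ⟩
    n div (2 * 2 ^ e)     ≡⟨ div≡/ n (2 * 2 ^ e) ⟩
    n / (2 * 2 ^ e)       ≡⟨ /-congʳ (*-comm 2 (2 ^ e)) ⟩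
    n / (2 ^ e * 2)       ≡⟨ m/n/o≡m/[n*o] n (2 ^ e) 2 ⟨
    x / 2                 ∎
    where open ≡-Reasoning
  x≤1+2[x/2] : x ≤ suc (2 * (x / 2))
  x≤1+2[x/2] = begin
    x                     ≡⟨ m≡m%n+[m/n]*n x 2 ⟩
    x % 2 + x / 2 * 2     ≤⟨ +-monoˡ-≤ (x / 2 * 2) (≤-pred (m%n<n x 2)) ⟩
    suc (x / 2 * 2)       ≡⟨ cong suc (*-comm (x / 2) 2) ⟩
    suc (2 * (x / 2))     ∎
    where open ≤-Reasoning

levelWidth-top : ∀ n w → levelWidth n w (rOf n w) ≡ n
levelWidth-top n w = trans (cong (λ t → n div (2 ^ t)) (n∸n≡0 (rOf n w))) (n/1≡n n)

-- Systems of grids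

IsPar-cases : ∀ {n d} r k P i {B Q : Point n d → Set} → IsPar r k P i B Q →
              (i < r × IsBlock (Grid k (P (suc i))) Q × (∀ y → B y → Q y)) ⊎ (¬ i < r)
IsPar-cases r k P i par with i <? r
... | yes i<r = inj₁ (i<r , par)
... | no  i≮r = inj₂ i≮r

module GridSystem (n d m : ℕ) (P : ℕ → List ℕ) (2k≤n : 2 * suc (suc m) ≤ n)
                  (sys : IsSystem n (suc d) (suc (suc m)) (2 * suc (suc m)) P) where

  private
    ℓ = suc m
    k = suc ℓ
    K = 2 * k
    r = rOf n K
    W = levelWidth n K

  level-sum : ∀ {j} → j ≤ r → sumL (P j) ≡ n
  level-sum j≤r = proj₂ (proj₁ sys _ j≤r)

  level-sizes : ∀ {j} → j ≤ r → ∀ {v} → v < n →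
                intervalSize (P j) v ≡ W j ⊎ intervalSize (P j) v ≡ suc (W j)
  level-sizes j≤r v<n = size-All (P _) (proj₁ (proj₁ sys _ j≤r)) (subst (_ <_) (sym (level-sum j≤r)) v<n)

  width≤size : ∀ {j} → j ≤ r → ∀ {v} → v < n → W j ≤ intervalSize (P j) v
  width≤size {j} j≤r v<n with level-sizes j≤r v<n
  ... | inj₁ size≡W   = ≤-reflexive (sym size≡W)
  ... | inj₂ size≡1+W = subst (W j ≤_) (sym size≡1+W) (n≤1+n (W j))

  K≤size : ∀ {j} → j ≤ r → ∀ {v} → v < n → K ≤ intervalSize (P j) v
  K≤size {j} j≤r v<n = ≤-trans (levelWidth-lower n K 2k≤n j) (width≤size j≤r v<n)

  ℓ≤size : ∀ {j} → j ≤ r → ∀ {v} → v < n → ℓ ≤ intervalSize (P j) v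
  ℓ≤size j≤r v<n = ≤-trans (≤-trans (n≤1+n ℓ) (m≤m+n k _)) (K≤size j≤r v<n)

  heads-nested : ∀ {i} → i < r → ∀ {u} → u < n → InHead ℓ (P (suc i)) u → InHead ℓ (P i) u
  heads-nested {i} i<r {u} u<n head′ =
    subst (InHead ℓ (P i)) (trans (cong toℕ (lookup-replicate (proj₁ on-grid) ū)) (toℕ-fromℕ< u<n))
          (proj₂ on-grid)
    where
    ū = fromℕ< u<n
    on-grid : Grid k (P i) (replicate (suc d) ū)
    on-grid = proj₂ sys i i<r (replicate (suc d) ū)
                (fzero , subst (InHead ℓ (P (suc i))) (sym (toℕ-fromℕ< u<n)) head′)

  level-size-step : ∀ {i} → i < r → ∀ {v} → v < n →
                    intervalSize (P (suc i)) v ≤ suc (2 * intervalSize (P i) v)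
  level-size-step {i} i<r {v} v<n =
    parent-size≤ (P i) (P (suc i)) Σ≡ nested (W i) 3≤W sizes small (subst (v <_) (sym (level-sum i≤r)) v<n)
    where
    i≤r = <⇒≤ i<r
    fromΣ : ∀ {u} → u < sumL (P i) → u < n
    fromΣ = subst (_ <_) (level-sum i≤r)
    Σ≡ : sumL (P (suc i)) ≡ sumL (P i)
    Σ≡ = trans (level-sum i<r) (sym (level-sum i≤r))
    2[1+m]≤K : 2 * suc m ≤ K
    2[1+m]≤K = *-monoʳ-≤ 2 (n≤1+n (suc m))
    nested : ∀ {c} → IsStart (P (suc i)) c → IsStart (P i) c
    nested = starts-nested m (P i) (P (suc i)) Σ≡ (heads-nested i<r ∘ fromΣ)
      (≤-trans 2[1+m]≤K ∘ K≤size i≤r ∘ fromΣ) (≤-trans 2[1+m]≤K ∘ K≤size i<r ∘ fromΣ)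
    3≤W : 3 ≤ W i
    3≤W = ≤-trans (+-mono-≤ {2} {suc (suc m)} {1} (s≤s (s≤s z≤n)) (s≤s z≤n)) (levelWidth-lower n K 2k≤n i)
    sizes : ∀ {c} → c < sumL (P i) → intervalSize (P i) c ≡ W i ⊎ intervalSize (P i) c ≡ suc (W i)
    sizes = level-sizes i≤r ∘ fromΣ
    W′+1≤2[1+W] : suc (W (suc i)) ≤ 2 * suc (W i)
    W′+1≤2[1+W] = subst (suc (W (suc i)) ≤_) (sym (*-suc 2 (W i))) (s≤s (levelWidth-step n K i<r))
    small : ∀ {c} → c < sumL (P i) → intervalSize (P (suc i)) c ≤ 2 * suc (W i)
    small c<Σ with level-sizes i<r (fromΣ c<Σ)
    ... | inj₁ size≡W′   = ≤-trans (≤-reflexive size≡W′) (≤-trans (n≤1+n _) W′+1≤2[1+W])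
    ... | inj₂ size≡1+W′ = ≤-trans (≤-reflexive size≡1+W′) W′+1≤2[1+W]

  ParentBox : ℕ → Point n (suc d) → (Point n (suc d) → Set) → Set
  ParentBox i x₀ Q = Σ (Vec (ℕ × ℕ) (suc d)) λ b′ → Bounded {n} b′ × (∀ y → Q y → y ∈ᴮ b′)
    × (∀ c → width (lookup b′ c) + ℓ ≤ suc (2 * intervalSize (P i) (toℕ (lookup x₀ c))))

  inner-parent-box : ∀ {i} → i < r → ∀ {x₀} → ¬ Grid k (P i) x₀ →
                     ∀ {Q} → IsBlock (Grid k (P (suc i))) Q → Q x₀ → ParentBox i x₀ Q
  inner-parent-box {i} i<r {x₀} x₀∉G (q₀ , _ , Q⇔) Qx₀ =
    tailBox ℓ (P (suc i)) x₀ , tailBox-bounded ℓ (P (suc i)) (level-sum i<r) x₀ , Q⊆box , narrow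
    where
    x₀∉G′ : ¬ Grid k (P (suc i)) x₀
    x₀∉G′ = x₀∉G ∘ proj₂ sys i i<r x₀
    Q⊆box : ∀ y → _ → y ∈ᴮ tailBox ℓ (P (suc i)) x₀
    Q⊆box y Qy = component⊆tailBox ℓ (P (suc i)) (level-sum i<r) (s≤s z≤n) x₀∉G′
      (Conn-trans (Conn-sym (Equivalence.to (Q⇔ x₀) Qx₀)) (Equivalence.to (Q⇔ y) Qy))
    narrow : ∀ c → width (lookup (tailBox ℓ (P (suc i)) x₀) c) + ℓ
                   ≤ suc (2 * intervalSize (P i) (toℕ (lookup x₀ c)))
    narrow c = subst (λ I → width I + ℓ ≤ _) (sym (lookup-map c _ x₀)) (begin
      width (intervalTail ℓ (P (suc i)) v) + ℓ ≡⟨ cong (_+ ℓ) (width-intervalTail ℓ (P (suc i)) v) ⟩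
      intervalSize (P (suc i)) v ∸ ℓ + ℓ       ≡⟨ m∸n+n≡m (ℓ≤size i<r v<n) ⟩
      intervalSize (P (suc i)) v               ≤⟨ level-size-step i<r v<n ⟩
      suc (2 * intervalSize (P i) v)           ∎)
      where
      open ≤-Reasoning
      v = toℕ (lookup x₀ c)
      v<n = toℕ<n (lookup x₀ c)

  top-parent-box : ∀ {i} → i ≡ r → ∀ x₀ Q → ParentBox i x₀ Q
  top-parent-box {i} refl x₀ Q = fullBox n (suc d) , fullBox-bounded n (suc d) , (λ y _ → ∈-fullBox y) , narrow
    where
    narrow : ∀ c → width (lookup (fullBox n (suc d)) c) + ℓ ≤ suc (2 * intervalSize (P i) (toℕ (lookup x₀ c)))
    narrow c = subst (λ I → width I + ℓ ≤ suc (2 * s)) (sym (lookup-replicate c (0 , n))) (begin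
      n + ℓ                  ≤⟨ +-mono-≤ n≤s (ℓ≤size ≤-refl v<n) ⟩
      s + s                  ≡⟨ cong (s +_) (+-identityʳ s) ⟨
      2 * s                  ≤⟨ n≤1+n (2 * s) ⟩
      suc (2 * s)            ∎)
      where
      open ≤-Reasoning
      v = toℕ (lookup x₀ c)
      v<n = toℕ<n (lookup x₀ c)
      s = intervalSize (P r) v
      n≤s : n ≤ s
      n≤s = subst (_≤ s) (levelWidth-top n K) (width≤size ≤-refl v<n)

  parent-box : ∀ {i} → i ≤ r → ∀ {x₀} → ¬ Grid k (P i) x₀ →
               ∀ {B Q} → B x₀ → IsPar r k P i B Q → ParentBox i x₀ Q
  parent-box {i} i≤r {x₀} x₀∉G {Q = Q} Bx₀ par with IsPar-cases r k P i par
  ... | inj₁ (i<r , Q-block , B⊆Q) = inner-parent-box i<r x₀∉G Q-block (B⊆Q x₀ Bx₀)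
  ... | inj₂ i≮r                   = top-parent-box (≤-antisym i≤r (≮⇒≥ i≮r)) x₀ Q

  narrow-tailBox : ∀ {i} → i ≤ r → ∀ x₀ (b′ : Vec (ℕ × ℕ) (suc d)) →
                   (∀ c → width (lookup b′ c) + ℓ ≤ suc (2 * intervalSize (P i) (toℕ (lookup x₀ c)))) →
                   ∀ c → width (lookup b′ c) < 3 * width (lookup (tailBox ℓ (P i) x₀) c)
  narrow-tailBox {i} i≤r x₀ b′ bound c =
    subst (λ t → width (lookup b′ c) < 3 * t)
          (sym (trans (cong width (lookup-map c _ x₀)) (width-intervalTail ℓ (P i) v)))
      (tail-ratio ℓ (intervalSize (P i) v) _ (K≤size i≤r (toℕ<n (lookup x₀ c))) (bound c))
    where v = toℕ (lookup x₀ c)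

  block-ratio : ∀ {i} → i ≤ r → ∀ {B Q : Point n (suc d) → Set} {LB LQ} →
                IsBlock (Grid k (P i)) B → IsPar r k P i B Q → Enumerates LB B → Enumerates LQ Q →
                length LQ < 3 ^ suc d * length LB
  block-ratio {i} i≤r {B} {Q} {LB} {LQ} (x₀ , x₀∉G , B⇔) par enumB enumQ =
    via-parent (parent-box i≤r x₀∉G (Equivalence.from (B⇔ x₀) (here x₀∉G)) par)
    where
    box⊆B : ∀ z → z ∈ᴮ tailBox ℓ (P i) x₀ → B z
    box⊆B z z∈box = Equivalence.from (B⇔ z) (tailBox⊆component ℓ (P i) (level-sum i≤r) x₀∉G z∈box)
    via-parent : ParentBox i x₀ Q → length LQ < 3 ^ suc d * length LB
    via-parent (b′ , b′-bounded , Q⊆b′ , bound) =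
      length<-via-boxes (tailBox ℓ (P i) x₀) b′ (tailBox-bounded ℓ (P i) (level-sum i≤r) x₀) b′-bounded
        box⊆B Q⊆b′ (narrow-tailBox i≤r x₀ b′ bound) enumB enumQ

lemma7 : (n d k : ℕ) → 1 ≤ d → 2 ≤ k → 2 * k ≤ n → (P : ℕ → List ℕ) → IsSystem n d k (2 * k) P → ∀ i → i ≤ rOf n (2 * k) → (B : Point n d → Set) → IsBlock (Grid k (P i)) B → (Q : Point n d → Set) → IsPar (rOf n (2 * k)) k P i B Q → (LB LQ : List (Point n d)) → Enumerates LB B → Enumerates LQ Q → length LQ < 3 ^ d * length LB
lemma7 n (suc d) 1 _ (s≤s ()) _ _ _ _ _ _ _ _ _ _ _ _ _
lemma7 n (suc d) (suc (suc m)) _ _ 2k≤n P sys i i≤r B blockB Q par LB LQ enumB enumQ =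
  GridSystem.block-ratio n d m P 2k≤n sys i≤r blockB par enumB enumQ
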